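{- Let $r$ be a complex number and $n\ge0$ an integer. Then, as polynomials in $x$ (with $i=\sqrt{ -1}$), $$d_n^{(r)}(x)=\frac{i^nD_n^{(r)}(-i(1+2x))}{n!}\quad\text{and}\quad D_n^{(r)}(x)=(-i)^nn!\,d_n^{(r)}\Big(\frac{ix-1}{2}\Big).$$
   Context: For a complex number $a$ and integer $k\ge0$, $\binom{a}{k}=a(a-1)\cdots(a-k+1)/k!$. For a parameter $r$ and an integer $n\ge 0$, $d_n^{(r)}(x)=\sum_{k=0}^n\binom{x+r+k}{k}\binom{x-r}{n-k}$. The polynomials $D_n^{(r)}(x)$ are defined by $D_{ -1}^{(r)}(x)=0$, $D_0^{(r)}(x)=1$ and $D_{n+1}^{(r)}(x)=xD_n^{(r)}(x)-n(n+2r)D_{n-1}^{(r)}(x)$ for $n\ge0$. -}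

module Defs where

open import Level using (Level)
open import Data.Nat using (ℕ; zero; suc; _∸_)
open import Data.Nat using () renaming (_! to _!ℕ)
open import Data.Product using (_×_; _,_; proj₂)
open import Algebra.Bundles using (CommutativeRing)

-- Operations over an arbitrary commutative ring R, given a function
-- inv : ℕ → Carrier meant to be the inverse of (m+1) (the hypothesis that it
-- is an inverse is stated).
module Ops {c ℓ : Level} (R : CommutativeRing c ℓ) (inv : ℕ → CommutativeRing.Carrier R) where
  open CommutativeRing R hiding (zero)

  fromℕ : ℕ → Carrier
  fromℕ zero    = 0#
  fromℕ (suc n) = 1# + fromℕ n

  pow : Carrier → ℕ → Carrier
  pow a zero    = 1#
  pow a (suc n) = pow a n * a

  falling : Carrier → ℕ → Carrier
  falling a zero    = 1#
  falling a (suc k) = falling a k * (a - fromℕ k)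

  invFact : ℕ → Carrier
  invFact zero    = 1#
  invFact (suc k) = invFact k * inv k

  binom : Carrier → ℕ → Carrier
  binom a k = falling a k * invFact k

  sumTo : ℕ → (ℕ → Carrier) → Carrier
  sumTo zero    f = f zero
  sumTo (suc n) f = sumTo n f + f (suc n)

  d : Carrier → ℕ → Carrier → Carrier
  d r n x = sumTo n (λ k → binom (x + r + fromℕ k) k * binom (x - r) (n ∸ k))

  -- (D_{n-1}^{(r)}(x), D_n^{(r)}(x)), with D_{-1} = 0, D_0 = 1,
  -- D_{n+1} = x D_n - n(n+2r) D_{n-1}
  Dpair : Carrier → ℕ → Carrier → Carrier × Carrier
  Dpair r zero    x = 0# , 1#
  Dpair r (suc n) x with Dpair r n x
  ... | (Dm , Dn) = Dn , (x * Dn - (fromℕ n * (fromℕ n + (1# + 1#) * r)) * Dm)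

  D : Carrier → ℕ → Carrier → Carrier
  D r n x = proj₂ (Dpair r n x)

  fact : ℕ → Carrier
  fact n = fromℕ (n !ℕ)

-- d_n is the Cauchy product of a_k = binom(x+r+k, k) and b_j = binom(x-r, j), which satisfy
-- (k+1) a_{k+1} = (x+r+1+k) a_k and (j+1) b_{j+1} = (x-r-j) b_j.  Applying the Leibniz rule
-- for the Euler operator t d/dt to the product of their generating functions gives
-- (n+2) d_{n+2} = (2x+1) d_{n+1} + (n+1+2r) d_n.  So n! d_n and i^n D_n(-i(2x+1)) satisfy the
-- same three-term recurrence with the same two initial values, hence agree.  The second
-- identity is the first one at (ix-1)/2, where -i(1+2x) becomes x again.

module Submission where

open import Level using (Level)
open import Algebra.Bundles using (CommutativeRing)
open import Algebra.Solver.Ring.AlmostCommutativeRing using (fromCommutativeRing; _-Raw-AlmostCommutative⟶_)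
open import Data.Integer.Base as ℤ using (ℤ; +_; -[1+_]; _⊖_; _◃_)
import Data.Integer.Properties as ℤ
open import Data.Maybe.Base as Maybe using (Maybe)
open import Data.Nat.Base as ℕ using (ℕ; zero; suc; _∸_)
import Data.Nat.Properties as ℕ
open import Data.Product.Base using (_×_; _,_; proj₁; proj₂)
open import Data.Sign.Base as Sign using (Sign)
open import Relation.Binary.Consequences using (dec⇒weaklyDec)
import Relation.Binary.PropositionalEquality as ≡
open import Defs

module IntegerCoefficients {c ℓ : Level} (R : CommutativeRing c ℓ) where
  open CommutativeRing R
  open import Algebra.Properties.Ring ring using (-0#≈0#; -‿involutive; -‿distribˡ-*; -‿distribʳ-*; -‿+-comm)
  open import Algebra.Properties.CommutativeSemigroup +-commutativeSemigroup using (interchange)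
  open import Algebra.Properties.Semiring.Mult.TCOptimised semiring using (1+×; ×-homo-+; ×1-homo-*) renaming (_×_ to _×′_)
  open import Relation.Binary.Reasoning.Setoid setoid

  signed : Sign → Carrier → Carrier
  signed Sign.+ a = a
  signed Sign.- a = - a

  -- The optimised multiple (1 ×′ a = a) makes con (+ 1) evaluate to 1# itself, so that solver
  -- goals mention the ring's own constants.
  fromℤ : ℤ → Carrier
  fromℤ i = signed (ℤ.sign i) (ℤ.∣ i ∣ ×′ 1#)

  signed-cong : ∀ s {a b} → a ≈ b → signed s a ≈ signed s b
  signed-cong Sign.+ a≈b = a≈b
  signed-cong Sign.- a≈b = -‿cong a≈b

  signed-* : ∀ s t a b → signed (s Sign.* t) (a * b) ≈ signed s a * signed t b
  signed-* Sign.+ Sign.+ a b = refl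
  signed-* Sign.+ Sign.- a b = -‿distribʳ-* a b
  signed-* Sign.- Sign.+ a b = -‿distribˡ-* a b
  signed-* Sign.- Sign.- a b = begin
    a * b        ≈⟨ -‿involutive (a * b) ⟨
    - - (a * b)  ≈⟨ -‿cong (-‿distribʳ-* a b) ⟩
    - (a * - b)  ≈⟨ -‿distribˡ-* a (- b) ⟩
    - a * - b    ∎

  fromℤ-◃ : ∀ s n → fromℤ (s ◃ n) ≈ signed s (n ×′ 1#)
  fromℤ-◃ Sign.+ zero    = refl
  fromℤ-◃ Sign.- zero    = sym -0#≈0#
  fromℤ-◃ Sign.+ (suc n) = refl
  fromℤ-◃ Sign.- (suc n) = refl

  fromℤ-⊖ : ∀ m n → fromℤ (m ⊖ n) ≈ m ×′ 1# - n ×′ 1#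
  fromℤ-⊖ m       zero    = sym (trans (+-congˡ -0#≈0#) (+-identityʳ _))
  fromℤ-⊖ zero    (suc n) = sym (+-identityˡ _)
  fromℤ-⊖ (suc m) (suc n) = begin
    fromℤ (suc m ⊖ suc n)      ≡⟨ ≡.cong fromℤ (ℤ.[1+m]⊖[1+n]≡m⊖n m n) ⟩
    fromℤ (m ⊖ n)              ≈⟨ fromℤ-⊖ m n ⟩
    M - N                      ≈⟨ +-identityˡ (M - N) ⟨
    0# + (M - N)               ≈⟨ +-congʳ (-‿inverseʳ 1#) ⟨
    (1# - 1#) + (M - N)        ≈⟨ interchange 1# (- 1#) M (- N) ⟩
    (1# + M) + (- 1# - N)      ≈⟨ +-cong (1+× m 1#) (trans (-‿cong (1+× n 1#)) (sym (-‿+-comm 1# N))) ⟨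
    suc m ×′ 1# - suc n ×′ 1#  ∎
    where
    M = m ×′ 1#
    N = n ×′ 1#

  fromℤ-+ : ∀ i j → fromℤ (i ℤ.+ j) ≈ fromℤ i + fromℤ j
  fromℤ-+ (+ m)    (+ n)    = ×-homo-+ 1# m n
  fromℤ-+ (+ m)    -[1+ n ] = fromℤ-⊖ m (suc n)
  fromℤ-+ -[1+ m ] (+ n)    = trans (fromℤ-⊖ n (suc m)) (+-comm _ _)
  fromℤ-+ -[1+ m ] -[1+ n ] = begin
    - (suc (suc (m ℕ.+ n)) ×′ 1#)  ≡⟨ ≡.cong (λ k → - (suc k ×′ 1#)) (ℕ.+-suc m n) ⟨
    - ((suc m ℕ.+ suc n) ×′ 1#)    ≈⟨ -‿cong (×-homo-+ 1# (suc m) (suc n)) ⟩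
    - (suc m ×′ 1# + suc n ×′ 1#)  ≈⟨ -‿+-comm _ _ ⟨
    - (suc m ×′ 1#) - suc n ×′ 1#  ∎

  fromℤ-* : ∀ i j → fromℤ (i ℤ.* j) ≈ fromℤ i * fromℤ j
  fromℤ-* i j = begin
    fromℤ (s ◃ (ℤ.∣ i ∣ ℕ.* ℤ.∣ j ∣))             ≈⟨ fromℤ-◃ s (ℤ.∣ i ∣ ℕ.* ℤ.∣ j ∣) ⟩
    signed s ((ℤ.∣ i ∣ ℕ.* ℤ.∣ j ∣) ×′ 1#)        ≈⟨ signed-cong s (×1-homo-* ℤ.∣ i ∣ ℤ.∣ j ∣) ⟩
    signed s ((ℤ.∣ i ∣ ×′ 1#) * (ℤ.∣ j ∣ ×′ 1#))  ≈⟨ signed-* (ℤ.sign i) (ℤ.sign j) _ _ ⟩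
    fromℤ i * fromℤ j                             ∎
    where
    s = ℤ.sign i Sign.* ℤ.sign j

  fromℤ-neg : ∀ i → fromℤ (ℤ.- i) ≈ - fromℤ i
  fromℤ-neg (+ zero)  = sym -0#≈0#
  fromℤ-neg (+ suc n) = refl
  fromℤ-neg -[1+ n ]  = sym (-‿involutive _)

  homomorphism : ℤ.+-*-rawRing -Raw-AlmostCommutative⟶ fromCommutativeRing R
  homomorphism = record
    { ⟦_⟧ = fromℤ ; +-homo = fromℤ-+ ; *-homo = fromℤ-* ; -‿homo = fromℤ-neg
    ; 0-homo = refl ; 1-homo = refl }

  fromℤ-weaklyDecidable : ∀ i j → Maybe (fromℤ i ≈ fromℤ j)
  fromℤ-weaklyDecidable i j = Maybe.map (λ { ≡.refl → refl }) (dec⇒weaklyDec ℤ._≟_ i j)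

  open import Algebra.Solver.Ring ℤ.+-*-rawRing (fromCommutativeRing R) homomorphism fromℤ-weaklyDecidable public

  :0 :1 :2 : ∀ {m} → Polynomial m
  :0 = con (+ 0)
  :1 = con (+ 1)
  :2 = :1 :+ :1

module _ {c ℓ : Level} (R : CommutativeRing c ℓ) (inv : ℕ → CommutativeRing.Carrier R) where
  open CommutativeRing R hiding (zero)
  open Ops R inv
  open IntegerCoefficients R using (solve; _:=_; :0; :1; :2; _:+_; _:-_; _:*_; :-_)
  open import Algebra.Properties.Ring ring using (-‿involutive; -‿distribˡ-*; -‿+-comm; -1*x≈-x)
  open import Algebra.Properties.CommutativeSemigroup +-commutativeSemigroup using (interchange)
  open import Relation.Binary.Reasoning.Setoid setoid

  fromℕ-+ : ∀ m n → fromℕ (m ℕ.+ n) ≈ fromℕ m + fromℕ n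
  fromℕ-+ zero    n = sym (+-identityˡ _)
  fromℕ-+ (suc m) n = trans (+-congˡ (fromℕ-+ m n)) (sym (+-assoc _ _ _))

  fromℕ-* : ∀ m n → fromℕ (m ℕ.* n) ≈ fromℕ m * fromℕ n
  fromℕ-* zero    n = sym (zeroˡ _)
  fromℕ-* (suc m) n = begin
    fromℕ (n ℕ.+ m ℕ.* n)             ≈⟨ fromℕ-+ n (m ℕ.* n) ⟩
    fromℕ n + fromℕ (m ℕ.* n)         ≈⟨ +-cong (sym (*-identityˡ _)) (fromℕ-* m n) ⟩
    1# * fromℕ n + fromℕ m * fromℕ n  ≈⟨ distribʳ _ _ _ ⟨
    (1# + fromℕ m) * fromℕ n          ∎

  fact-suc : ∀ n → fact (suc n) ≈ fromℕ (suc n) * fact n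
  fact-suc n = fromℕ-* (suc n) (n ℕ.!)

  pow-*-inverse : ∀ {a b} → a * b ≈ 1# → ∀ n → pow a n * pow b n ≈ 1#
  pow-*-inverse ab≈1 zero    = *-identityˡ 1#
  pow-*-inverse {a} {b} ab≈1 (suc n) = begin
    (pow a n * a) * (pow b n * b)
      ≈⟨ solve 4 (λ p q a b → (p :* a) :* (q :* b) := (p :* q) :* (a :* b)) refl (pow a n) (pow b n) a b ⟩
    (pow a n * pow b n) * (a * b)
      ≈⟨ *-cong (pow-*-inverse ab≈1 n) ab≈1 ⟩
    1# * 1#
      ≈⟨ *-identityˡ 1# ⟩
    1#  ∎

  falling-cong : ∀ k {a b} → a ≈ b → falling a k ≈ falling b k
  falling-cong zero    a≈b = refl
  falling-cong (suc k) a≈b = *-cong (falling-cong k a≈b) (+-congʳ a≈b)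

  falling-suc : ∀ a k → falling a (suc k) ≈ a * falling (a - 1#) k
  falling-suc a zero    = solve 1 (λ a → :1 :* (a :- :0) := a :* :1) refl a
  falling-suc a (suc k) = begin
    falling a (suc k) * (a - (1# + fromℕ k))
      ≈⟨ *-congʳ (falling-suc a k) ⟩
    (a * falling (a - 1#) k) * (a - (1# + fromℕ k))
      ≈⟨ solve 3 (λ a p K → (a :* p) :* (a :- (:1 :+ K)) := a :* (p :* ((a :- :1) :- K))) refl a (falling (a - 1#) k) (fromℕ k) ⟩
    a * (falling (a - 1#) k * ((a - 1#) - fromℕ k))  ∎

  binom-cong : ∀ k {a b} → a ≈ b → binom a k ≈ binom b k
  binom-cong k a≈b = *-congʳ (falling-cong k a≈b)

  module _ (inv-correct : ∀ m → fromℕ (suc m) * inv m ≈ 1#) where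

    suc*invFact-suc : ∀ k → fromℕ (suc k) * invFact (suc k) ≈ invFact k
    suc*invFact-suc k = begin
      fromℕ (suc k) * (invFact k * inv k)
        ≈⟨ solve 3 (λ s f v → s :* (f :* v) := f :* (s :* v)) refl (fromℕ (suc k)) (invFact k) (inv k) ⟩
      invFact k * (fromℕ (suc k) * inv k)
        ≈⟨ *-congˡ (inv-correct k) ⟩
      invFact k * 1#
        ≈⟨ *-identityʳ _ ⟩
      invFact k  ∎

    fact*invFact : ∀ n → fact n * invFact n ≈ 1#
    fact*invFact zero    = solve 0 ((:1 :+ :0) :* :1 := :1) refl
    fact*invFact (suc n) = begin
      fact (suc n) * invFact (suc n)
        ≈⟨ *-congʳ (fact-suc n) ⟩
      (fromℕ (suc n) * fact n) * invFact (suc n)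
        ≈⟨ solve 3 (λ s f v → (s :* f) :* v := f :* (s :* v)) refl (fromℕ (suc n)) (fact n) (invFact (suc n)) ⟩
      fact n * (fromℕ (suc n) * invFact (suc n))
        ≈⟨ *-congˡ (suc*invFact-suc n) ⟩
      fact n * invFact n
        ≈⟨ fact*invFact n ⟩
      1#  ∎

    fact*-cancel : ∀ n {a b} → fact n * a ≈ b → a ≈ b * invFact n
    fact*-cancel n {a} {b} n!a≈b = begin
      a                         ≈⟨ *-identityˡ a ⟨
      1# * a                    ≈⟨ *-congʳ (fact*invFact n) ⟨
      (fact n * invFact n) * a  ≈⟨ solve 3 (λ f v a → (f :* v) :* a := (f :* a) :* v) refl (fact n) (invFact n) a ⟩
      (fact n * a) * invFact n  ≈⟨ *-congʳ n!a≈b ⟩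
      b * invFact n             ∎

    binom-suc : ∀ a k → fromℕ (suc k) * binom a (suc k) ≈ (a - fromℕ k) * binom a k
    binom-suc a k = begin
      fromℕ (suc k) * (falling a k * (a - fromℕ k) * invFact (suc k))
        ≈⟨ solve 4 (λ s f t v → s :* (f :* t :* v) := t :* (f :* (s :* v)))
                   refl (fromℕ (suc k)) (falling a k) (a - fromℕ k) (invFact (suc k)) ⟩
      (a - fromℕ k) * (falling a k * (fromℕ (suc k) * invFact (suc k)))
        ≈⟨ *-congˡ (*-congˡ (suc*invFact-suc k)) ⟩
      (a - fromℕ k) * binom a k  ∎

    binom-absorption : ∀ a k → fromℕ (suc k) * binom a (suc k) ≈ a * binom (a - 1#) k
    binom-absorption a k = begin
      fromℕ (suc k) * (falling a (suc k) * invFact (suc k))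
        ≈⟨ *-congˡ (*-congʳ (falling-suc a k)) ⟩
      fromℕ (suc k) * ((a * falling (a - 1#) k) * invFact (suc k))
        ≈⟨ solve 4 (λ s a f v → s :* ((a :* f) :* v) := a :* (f :* (s :* v)))
                   refl (fromℕ (suc k)) a (falling (a - 1#) k) (invFact (suc k)) ⟩
      a * (falling (a - 1#) k * (fromℕ (suc k) * invFact (suc k)))
        ≈⟨ *-congˡ (*-congˡ (suc*invFact-suc k)) ⟩
      a * binom (a - 1#) k  ∎

  sumTo-cong≤ : ∀ n {f g : ℕ → Carrier} → (∀ k → k ℕ.≤ n → f k ≈ g k) → sumTo n f ≈ sumTo n g
  sumTo-cong≤ zero    f≈g = f≈g 0 ℕ.z≤n
  sumTo-cong≤ (suc n) f≈g = +-cong (sumTo-cong≤ n (λ k k≤n → f≈g k (ℕ.m≤n⇒m≤1+n k≤n))) (f≈g (suc n) ℕ.≤-refl)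

  sumTo-cong : ∀ n {f g : ℕ → Carrier} → (∀ k → f k ≈ g k) → sumTo n f ≈ sumTo n g
  sumTo-cong n f≈g = sumTo-cong≤ n (λ k _ → f≈g k)

  sumTo-+ : ∀ n (f g : ℕ → Carrier) → sumTo n (λ k → f k + g k) ≈ sumTo n f + sumTo n g
  sumTo-+ zero    f g = refl
  sumTo-+ (suc n) f g = begin
    sumTo n (λ k → f k + g k) + (f (suc n) + g (suc n))  ≈⟨ +-congʳ (sumTo-+ n f g) ⟩
    (sumTo n f + sumTo n g) + (f (suc n) + g (suc n))    ≈⟨ interchange _ _ _ _ ⟩
    (sumTo n f + f (suc n)) + (sumTo n g + g (suc n))    ∎

  sumTo-*ˡ : ∀ n a (f : ℕ → Carrier) → sumTo n (λ k → a * f k) ≈ a * sumTo n f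
  sumTo-*ˡ zero    a f = refl
  sumTo-*ˡ (suc n) a f = trans (+-congʳ (sumTo-*ˡ n a f)) (sym (distribˡ _ _ _))

  sumTo-neg : ∀ n (f : ℕ → Carrier) → sumTo n (λ k → - f k) ≈ - sumTo n f
  sumTo-neg zero    f = refl
  sumTo-neg (suc n) f = trans (+-congʳ (sumTo-neg n f)) (-‿+-comm _ _)

  sumTo-sucˡ : ∀ n (f : ℕ → Carrier) → sumTo (suc n) f ≈ f 0 + sumTo n (λ k → f (suc k))
  sumTo-sucˡ zero    f = refl
  sumTo-sucˡ (suc n) f = trans (+-congʳ (sumTo-sucˡ n f)) (+-assoc _ _ _)

  infixl 7 _⋆_
  _⋆_ : (ℕ → Carrier) → (ℕ → Carrier) → ℕ → Carrier
  (f ⋆ g) n = sumTo n (λ k → f k * g (n ∸ k))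

  -- For F = Σ f k tᵏ these are the coefficient sequences of t F′ and of F′.
  euler derivative : (ℕ → Carrier) → ℕ → Carrier
  euler f k      = fromℕ k * f k
  derivative f k = fromℕ (suc k) * f (suc k)

  ⋆-leibniz : ∀ f g n → (euler f ⋆ g) n + (f ⋆ euler g) n ≈ fromℕ n * (f ⋆ g) n
  ⋆-leibniz f g n = begin
    (euler f ⋆ g) n + (f ⋆ euler g) n                              ≈⟨ sumTo-+ n _ _ ⟨
    sumTo n (λ k → euler f k * g (n ∸ k) + f k * euler g (n ∸ k))  ≈⟨ sumTo-cong≤ n term ⟩
    sumTo n (λ k → fromℕ n * (f k * g (n ∸ k)))                    ≈⟨ sumTo-*ˡ n _ _ ⟩
    fromℕ n * (f ⋆ g) n                                            ∎
    where
    term : ∀ k → k ℕ.≤ n → euler f k * g (n ∸ k) + f k * euler g (n ∸ k) ≈ fromℕ n * (f k * g (n ∸ k))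
    term k k≤n = begin
      euler f k * g (n ∸ k) + f k * euler g (n ∸ k)
        ≈⟨ solve 4 (λ K J u v → (K :* u) :* v :+ u :* (J :* v) := (K :+ J) :* (u :* v)) refl (fromℕ k) (fromℕ (n ∸ k)) (f k) (g (n ∸ k)) ⟩
      (fromℕ k + fromℕ (n ∸ k)) * (f k * g (n ∸ k))
        ≈⟨ *-congʳ (fromℕ-+ k (n ∸ k)) ⟨
      fromℕ (k ℕ.+ (n ∸ k)) * (f k * g (n ∸ k))
        ≡⟨ ≡.cong (λ m → fromℕ m * (f k * g (n ∸ k))) (ℕ.m+[n∸m]≡n k≤n) ⟩
      fromℕ n * (f k * g (n ∸ k))  ∎

  euler-⋆-suc : ∀ f g n → (euler f ⋆ g) (suc n) ≈ (derivative f ⋆ g) n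
  euler-⋆-suc f g n = begin
    (euler f ⋆ g) (suc n)                          ≈⟨ sumTo-sucˡ n _ ⟩
    (0# * f 0) * g (suc n) + (derivative f ⋆ g) n  ≈⟨ +-congʳ (trans (*-congʳ (zeroˡ _)) (zeroˡ _)) ⟩
    0# + (derivative f ⋆ g) n                      ≈⟨ +-identityˡ _ ⟩
    (derivative f ⋆ g) n                           ∎

  ⋆-euler-suc : ∀ f g n → (f ⋆ euler g) (suc n) ≈ (f ⋆ derivative g) n
  ⋆-euler-suc f g n = begin
    (f ⋆ euler g) (suc n)      ≈⟨ +-cong (sumTo-cong≤ n reindex) last-term ⟩
    (f ⋆ derivative g) n + 0#  ≈⟨ +-identityʳ _ ⟩
    (f ⋆ derivative g) n       ∎
    where
    reindex : ∀ k → k ℕ.≤ n → f k * euler g (suc n ∸ k) ≈ f k * derivative g (n ∸ k)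
    reindex k k≤n = reflexive (≡.cong (λ m → f k * euler g m) (ℕ.+-∸-assoc 1 k≤n))
    last-term : f (suc n) * euler g (n ∸ n) ≈ 0#
    last-term = begin
      f (suc n) * (fromℕ (n ∸ n) * g (n ∸ n))  ≡⟨ ≡.cong (λ m → f (suc n) * (fromℕ m * g m)) (ℕ.n∸n≡0 n) ⟩
      f (suc n) * (0# * g 0)                   ≈⟨ trans (*-congˡ (zeroˡ _)) (zeroʳ _) ⟩
      0#                                       ∎

  module _ (f g : ℕ → Carrier) (α β : Carrier)
           (f-rec : ∀ k → derivative f k ≈ (α + fromℕ k) * f k)
           (g-rec : ∀ j → derivative g j ≈ (β - fromℕ j) * g j) where
    private
      P Q : ℕ → Carrier
      P = euler f ⋆ g
      Q = f ⋆ euler g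

      P-suc : ∀ n → P (suc n) ≈ α * (f ⋆ g) n + P n
      P-suc n = begin
        P (suc n)                                                      ≈⟨ euler-⋆-suc f g n ⟩
        (derivative f ⋆ g) n                                           ≈⟨ sumTo-cong n split ⟩
        sumTo n (λ k → α * (f k * g (n ∸ k)) + euler f k * g (n ∸ k))  ≈⟨ sumTo-+ n _ _ ⟩
        sumTo n (λ k → α * (f k * g (n ∸ k))) + P n                    ≈⟨ +-congʳ (sumTo-*ˡ n _ _) ⟩
        α * (f ⋆ g) n + P n                                            ∎
        where
        split : ∀ k → derivative f k * g (n ∸ k) ≈ α * (f k * g (n ∸ k)) + euler f k * g (n ∸ k)
        split k = trans (*-congʳ (f-rec k))
          (solve 4 (λ a K u v → (a :+ K) :* u :* v := a :* (u :* v) :+ K :* u :* v) refl α (fromℕ k) (f k) (g (n ∸ k)))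

      Q-suc : ∀ n → Q (suc n) ≈ β * (f ⋆ g) n - Q n
      Q-suc n = begin
        Q (suc n)
          ≈⟨ ⋆-euler-suc f g n ⟩
        (f ⋆ derivative g) n
          ≈⟨ sumTo-cong n split ⟩
        sumTo n (λ k → β * (f k * g (n ∸ k)) + - (f k * euler g (n ∸ k)))
          ≈⟨ sumTo-+ n _ _ ⟩
        sumTo n (λ k → β * (f k * g (n ∸ k))) + sumTo n (λ k → - (f k * euler g (n ∸ k)))
          ≈⟨ +-cong (sumTo-*ˡ n _ _) (sumTo-neg n _) ⟩
        β * (f ⋆ g) n - Q n  ∎
        where
        split : ∀ k → f k * derivative g (n ∸ k) ≈ β * (f k * g (n ∸ k)) + - (f k * euler g (n ∸ k))
        split k = trans (*-congˡ (g-rec (n ∸ k)))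
          (solve 4 (λ b J u v → u :* ((b :- J) :* v) := b :* (u :* v) :+ :- (u :* (J :* v))) refl β (fromℕ (n ∸ k)) (f k) (g (n ∸ k)))

      ⋆-suc : ∀ n → fromℕ (suc n) * (f ⋆ g) (suc n) ≈ (α + β) * (f ⋆ g) n + (P n - Q n)
      ⋆-suc n = begin
        fromℕ (suc n) * (f ⋆ g) (suc n)
          ≈⟨ ⋆-leibniz f g (suc n) ⟨
        P (suc n) + Q (suc n)
          ≈⟨ +-cong (P-suc n) (Q-suc n) ⟩
        (α * (f ⋆ g) n + P n) + (β * (f ⋆ g) n - Q n)
          ≈⟨ solve 5 (λ a b h p q → (a :* h :+ p) :+ (b :* h :- q) := (a :+ b) :* h :+ (p :- q)) refl α β ((f ⋆ g) n) (P n) (Q n) ⟩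
        (α + β) * (f ⋆ g) n + (P n - Q n)  ∎

      P-Q-suc : ∀ n → P (suc n) - Q (suc n) ≈ (α - β + fromℕ n) * (f ⋆ g) n
      P-Q-suc n = begin
        P (suc n) - Q (suc n)
          ≈⟨ +-cong (P-suc n) (-‿cong (Q-suc n)) ⟩
        (α * (f ⋆ g) n + P n) - (β * (f ⋆ g) n - Q n)
          ≈⟨ solve 5 (λ a b h p q → (a :* h :+ p) :- (b :* h :- q) := (a :- b) :* h :+ (p :+ q)) refl α β ((f ⋆ g) n) (P n) (Q n) ⟩
        (α - β) * (f ⋆ g) n + (P n + Q n)
          ≈⟨ +-congˡ (⋆-leibniz f g n) ⟩
        (α - β) * (f ⋆ g) n + fromℕ n * (f ⋆ g) n
          ≈⟨ distribʳ _ _ _ ⟨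
        (α - β + fromℕ n) * (f ⋆ g) n  ∎

    ⋆-recurrence-initial : fromℕ 1 * (f ⋆ g) 1 ≈ (α + β) * (f ⋆ g) 0
    ⋆-recurrence-initial = begin
      fromℕ 1 * (f ⋆ g) 1
        ≈⟨ ⋆-suc 0 ⟩
      (α + β) * (f ⋆ g) 0 + (P 0 - Q 0)
        ≈⟨ +-congˡ (solve 2 (λ u v → :0 :* u :* v :- u :* (:0 :* v) := :0) refl (f 0) (g 0)) ⟩
      (α + β) * (f ⋆ g) 0 + 0#
        ≈⟨ +-identityʳ _ ⟩
      (α + β) * (f ⋆ g) 0  ∎

    ⋆-recurrence : ∀ n → fromℕ (suc (suc n)) * (f ⋆ g) (suc (suc n)) ≈ (α + β) * (f ⋆ g) (suc n) + (α - β + fromℕ n) * (f ⋆ g) n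
    ⋆-recurrence n = trans (⋆-suc (suc n)) (+-congˡ (P-Q-suc n))

  Recurrence : Carrier → (ℕ → Carrier) → (ℕ → Carrier) → Set ℓ
  Recurrence p q u = ∀ n → u (suc (suc n)) ≈ p * u (suc n) + q n * u n

  recurrence-unique : ∀ {p q u v} → Recurrence p q u → Recurrence p q v →
                      u 0 ≈ v 0 → u 1 ≈ v 1 → ∀ n → u n ≈ v n
  recurrence-unique {p} {q} {u} {v} u-rec v-rec u₀≈v₀ u₁≈v₁ n = proj₁ (consecutive n)
    where
    consecutive : ∀ n → u n ≈ v n × u (suc n) ≈ v (suc n)
    consecutive zero    = u₀≈v₀ , u₁≈v₁
    consecutive (suc n) = proj₂ (consecutive n) , (begin
      u (suc (suc n))            ≈⟨ u-rec n ⟩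
      p * u (suc n) + q n * u n  ≈⟨ +-cong (*-congˡ (proj₂ (consecutive n))) (*-congˡ (proj₁ (consecutive n))) ⟩
      p * v (suc n) + q n * v n  ≈⟨ v-rec n ⟨
      v (suc (suc n))            ∎)

  recurrence-cong : ∀ {p p′ q q′ u} → p ≈ p′ → (∀ n → q n ≈ q′ n) → Recurrence p q u → Recurrence p′ q′ u
  recurrence-cong p≈p′ q≈q′ u-rec n = trans (u-rec n) (+-cong (*-congʳ p≈p′) (*-congʳ (q≈q′ n)))

  pow-*-recurrence : ∀ a {p q u} → Recurrence p q u → Recurrence (a * p) (λ n → (a * a) * q n) (λ n → pow a n * u n)
  pow-*-recurrence a {p} {q} {u} u-rec n = begin
    ((pow a n * a) * a) * u (suc (suc n))
      ≈⟨ *-congˡ (u-rec n) ⟩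
    ((pow a n * a) * a) * (p * u (suc n) + q n * u n)
      ≈⟨ solve 6 (λ P a p q u₁ u₀ → ((P :* a) :* a) :* (p :* u₁ :+ q :* u₀)
                                  := (a :* p) :* ((P :* a) :* u₁) :+ ((a :* a) :* q) :* (P :* u₀))
                 refl (pow a n) a p (q n) (u (suc n)) (u n) ⟩
    (a * p) * ((pow a n * a) * u (suc n)) + ((a * a) * q n) * (pow a n * u n)  ∎

  fact-*-recurrence : ∀ {p} {q u : ℕ → Carrier} → (∀ n → fromℕ (suc (suc n)) * u (suc (suc n)) ≈ p * u (suc n) + q n * u n) →
                      Recurrence p (λ n → fromℕ (suc n) * q n) (λ n → fact n * u n)
  fact-*-recurrence {p} {q} {u} u-rec n = begin
    fact (suc (suc n)) * u (suc (suc n))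
      ≈⟨ *-congʳ (fact-suc (suc n)) ⟩
    (fromℕ (suc (suc n)) * F) * u (suc (suc n))
      ≈⟨ solve 3 (λ s F u → (s :* F) :* u := F :* (s :* u)) refl (fromℕ (suc (suc n))) F (u (suc (suc n))) ⟩
    F * (fromℕ (suc (suc n)) * u (suc (suc n)))
      ≈⟨ *-congˡ (u-rec n) ⟩
    F * (p * u (suc n) + q n * u n)
      ≈⟨ solve 5 (λ F p q u₁ u₀ → F :* (p :* u₁ :+ q :* u₀) := p :* (F :* u₁) :+ q :* (F :* u₀)) refl F p (q n) (u (suc n)) (u n) ⟩
    p * (F * u (suc n)) + q n * (F * u n)
      ≈⟨ +-congˡ (*-congˡ (*-congʳ (fact-suc n))) ⟩
    p * (F * u (suc n)) + q n * ((fromℕ (suc n) * fact n) * u n)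
      ≈⟨ +-congˡ (solve 4 (λ q s f u → q :* ((s :* f) :* u) := (s :* q) :* (f :* u)) refl (q n) (fromℕ (suc n)) (fact n) (u n)) ⟩
    p * (F * u (suc n)) + (fromℕ (suc n) * q n) * (fact n * u n)  ∎
    where
    F = fact (suc n)

  D-weight : Carrier → ℕ → Carrier
  D-weight r n = fromℕ (suc n) * (fromℕ (suc n) + (1# + 1#) * r)

  D-recurrence : ∀ r x → Recurrence x (λ n → - D-weight r n) (λ n → D r n x)
  D-recurrence r x n = +-congˡ (-‿distribˡ-* (D-weight r n) (D r n x))

  D-cong : ∀ r n {x y} → x ≈ y → D r n x ≈ D r n y
  D-cong r n x≈y = recurrence-unique (D-recurrence r _) (recurrence-cong (sym x≈y) (λ _ → refl) (D-recurrence r _))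
    refl (+-congʳ (*-congʳ x≈y)) n

  module _ (inv-correct : ∀ m → fromℕ (suc m) * inv m ≈ 1#) (r x : Carrier) where
    private
      α β z : Carrier
      α = x + r + 1#
      β = x - r
      z = 1# + (1# + 1#) * x

      A B : ℕ → Carrier
      A k = binom (x + r + fromℕ k) k
      B   = binom β

      A-rec : ∀ k → derivative A k ≈ (α + fromℕ k) * A k
      A-rec k = begin
        fromℕ (suc k) * binom (x + r + (1# + K)) (suc k)      ≈⟨ binom-absorption inv-correct (x + r + (1# + K)) k ⟩
        (x + r + (1# + K)) * binom (x + r + (1# + K) - 1#) k  ≈⟨ *-cong regroup (binom-cong k shift) ⟩
        (α + K) * A k                                         ∎
        where
        K = fromℕ k
        regroup : x + r + (1# + K) ≈ α + K
        regroup = solve 3 (λ x r K → x :+ r :+ (:1 :+ K) := x :+ r :+ :1 :+ K) refl x r K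
        shift : x + r + (1# + K) - 1# ≈ x + r + K
        shift = solve 3 (λ x r K → x :+ r :+ (:1 :+ K) :- :1 := x :+ r :+ K) refl x r K

      B-rec : ∀ j → derivative B j ≈ (β - fromℕ j) * B j
      B-rec = binom-suc inv-correct β

    fact*d-recurrence : Recurrence z (D-weight r) (λ n → fact n * d r n x)
    fact*d-recurrence = recurrence-cong
      (solve 2 (λ x r → x :+ r :+ :1 :+ (x :- r) := :1 :+ :2 :* x) refl x r)
      (λ n → solve 3 (λ x r N → (:1 :+ N) :* (x :+ r :+ :1 :- (x :- r) :+ N) := (:1 :+ N) :* ((:1 :+ N) :+ :2 :* r))
                     refl x r (fromℕ n))
      (fact-*-recurrence (⋆-recurrence A B α β A-rec B-rec))

    fact*d₁ : fact 1 * d r 1 x ≈ z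
    fact*d₁ = trans (⋆-recurrence-initial A B α β A-rec B-rec)
      (solve 2 (λ x r → (x :+ r :+ :1 :+ (x :- r)) :* ((:1 :* :1) :* (:1 :* :1)) := :1 :+ :2 :* x) refl x r)

  module _ (i : Carrier) (i²≈-1 : i * i ≈ - 1#) where

    i*-[i*z]≈z : ∀ z → i * - (i * z) ≈ z
    i*-[i*z]≈z z = begin
      i * - (i * z)    ≈⟨ solve 2 (λ i z → i :* (:- (i :* z)) := :- ((i :* i) :* z)) refl i z ⟩
      - ((i * i) * z)  ≈⟨ -‿cong (*-congʳ i²≈-1) ⟩
      - (- 1# * z)     ≈⟨ -‿cong (-1*x≈-x z) ⟩
      - - z            ≈⟨ -‿involutive z ⟩
      z                ∎

    pow*D-recurrence : ∀ r z → Recurrence z (D-weight r) (λ n → pow i n * D r n (- (i * z)))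
    pow*D-recurrence r z = recurrence-cong (i*-[i*z]≈z z) i²*-w≈w (pow-*-recurrence i (D-recurrence r (- (i * z))))
      where
      i²*-w≈w : ∀ n → (i * i) * - D-weight r n ≈ D-weight r n
      i²*-w≈w n = trans (*-congʳ i²≈-1) (solve 1 (λ w → (:- :1) :* (:- w) := w) refl (D-weight r n))

    pow*D₁ : ∀ r z → pow i 1 * D r 1 (- (i * z)) ≈ z
    pow*D₁ r z = trans
      (solve 3 (λ i y r → (:1 :* i) :* (y :* :1 :- (:0 :* (:0 :+ :2 :* r)) :* :0) := i :* y) refl i (- (i * z)) r)
      (i*-[i*z]≈z z)

    module _ (inv-correct : ∀ m → fromℕ (suc m) * inv m ≈ 1#) (r : Carrier) where

      fact*d≈pow*D : ∀ x n → fact n * d r n x ≈ pow i n * D r n (- (i * (1# + (1# + 1#) * x)))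
      fact*d≈pow*D x = recurrence-unique (fact*d-recurrence inv-correct r x) (pow*D-recurrence r _)
        (solve 0 ((:1 :+ :0) :* ((:1 :* :1) :* (:1 :* :1)) := :1 :* :1) refl)
        (trans (fact*d₁ inv-correct r x) (sym (pow*D₁ r _)))

      d≈pow*D*invFact : ∀ n x → d r n x ≈ pow i n * D r n (- (i * (1# + (1# + 1#) * x))) * invFact n
      d≈pow*D*invFact n x = fact*-cancel inv-correct n (fact*d≈pow*D x n)

      D≈pow*fact*d : ∀ n x → D r n x ≈ pow (- i) n * fact n * d r n ((i * x - 1#) * inv 1)
      D≈pow*fact*d n x = begin
        D r n x                            ≈⟨ D-cong r n substitution-inverse ⟨
        D r n y                            ≈⟨ *-identityˡ _ ⟨
        1# * D r n y                       ≈⟨ *-congʳ (pow-*-inverse -i*i≈1 n) ⟨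
        (pow (- i) n * pow i n) * D r n y  ≈⟨ *-assoc _ _ _ ⟩
        pow (- i) n * (pow i n * D r n y)  ≈⟨ *-congˡ (fact*d≈pow*D x′ n) ⟨
        pow (- i) n * (fact n * d r n x′)  ≈⟨ *-assoc _ _ _ ⟨
        pow (- i) n * fact n * d r n x′    ∎
        where
        x′ = (i * x - 1#) * inv 1
        y  = - (i * (1# + (1# + 1#) * x′))

        -i*i≈1 : - i * i ≈ 1#
        -i*i≈1 = trans (sym (-‿distribˡ-* i i)) (trans (-‿cong i²≈-1) (-‿involutive 1#))

        substitution-inverse : y ≈ x
        substitution-inverse = begin
          y
            ≈⟨ solve 3 (λ i x v → :- (i :* (:1 :+ :2 :* ((i :* x :- :1) :* v)))
                                := :- (i :* (:1 :+ (i :* x :- :1) :* ((:1 :+ (:1 :+ :0)) :* v))))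
                       refl i x (inv 1) ⟩
          - (i * (1# + (i * x - 1#) * (fromℕ 2 * inv 1)))
            ≈⟨ -‿cong (*-congˡ (+-congˡ (*-congˡ (inv-correct 1)))) ⟩
          - (i * (1# + (i * x - 1#) * 1#))
            ≈⟨ solve 2 (λ i x → :- (i :* (:1 :+ (i :* x :- :1) :* :1)) := i :* (:- (i :* x))) refl i x ⟩
          i * - (i * x)
            ≈⟨ i*-[i*z]≈z x ⟩
          x  ∎

lemma3p1 : {c ℓ : Level} (R : CommutativeRing c ℓ) →
           let open CommutativeRing R in
           (i : Carrier) → i * i ≈ - 1# →
           (inv : ℕ → Carrier) →
           ((m : ℕ) → Ops.fromℕ R inv (suc m) * inv m ≈ 1#) →
           let open Ops R inv in
           (r : Carrier) (n : ℕ) (x : Carrier) →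
           (d r n x ≈ pow i n * D r n (- (i * (1# + (1# + 1#) * x))) * invFact n)
           × (D r n x ≈ pow (- i) n * fact n * d r n ((i * x - 1#) * inv 1))
lemma3p1 R i i²≈-1 inv inv-correct r n x =
  d≈pow*D*invFact R inv i i²≈-1 inv-correct r n x , D≈pow*fact*d R inv i i²≈-1 inv-correct r n x
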